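{- Let $n\ge1$, $d\ge0$. The number of sorted recurrent configurations on $S_{n,d}$ is \[ \frac{1}{n+1}\binom{2n+d}{n}\binom{n+d}{n}=\frac{1}{2n+1}\binom{2n+1}{n}\binom{2n+d}{d}. \]
   Context: The complete split graph $S_{n,d}$ has a sink $s$, clique vertices $v_1,\ldots,v_n$ and independent vertices $w_1,\ldots,w_d$; any two distinct vertices among $s,v_1,\ldots,v_n$ are adjacent, each $w_j$ is adjacent to each of $s,v_1,\ldots,v_n$, and no two $w_j$'s are adjacent. A configuration assigns non-negative integers to the non-sink vertices; a non-sink vertex is unstable if its number of grains is at least its degree, and toppling a vertex $v$ removes $\deg(v)$ grains from $v$ (if $v\ne s$) and adds one grain to each non-sink neighbour. A configuration is stable if no non-sink vertex is unstable; a stable configuration $c$ is recurrent iff there is an ordering $s=u_0,\ldots,u_{n+d}$ of all vertices such that from $c$, toppling $u_0,\ldots,u_{i-1}$ in turn makes $u_i$ unstable for each $i\ge1$. A configuration is sorted if $c(v_1)\ge\cdots\ge c(v_n)$ and $c(w_1)\ge\cdots\ge c(w_d)$. -}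

module Defs where

open import Data.Nat using (ℕ; zero; suc; _+_; _∸_; _≤_; _<_; _≥_)
open import Data.Fin using (Fin)
import Data.Fin as F
open import Data.Fin.Properties using () renaming (_≟_ to _≟ᶠ_)
open import Data.Vec using (Vec; lookup; updateAt; tabulate)
open import Data.List using (List; []; _∷_; map; _++_; allFin)
open import Data.Bool using (Bool; true; false; if_then_else_)
open import Data.Product using (Σ; _×_)
open import Data.Unit using (⊤)
open import Relation.Nullary using (does)
open import Data.List.Relation.Binary.Permutation.Propositional using (_↭_)

-- Vertices of the complete split graph S_{n,d}
data NonSink (n d : ℕ) : Set where
  vv : Fin n → NonSink n d
  ww : Fin d → NonSink n d

data Vertex (n d : ℕ) : Set where
  sink : Vertex n d
  ns   : NonSink n d → Vertex n d

adj : ∀ {n d} → Vertex n d → Vertex n d → Bool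
adj sink sink = false
adj sink (ns _) = true
adj (ns _) sink = true
adj (ns (vv i)) (ns (vv j)) = if does (i ≟ᶠ j) then false else true
adj (ns (vv _)) (ns (ww _)) = true
adj (ns (ww _)) (ns (vv _)) = true
adj (ns (ww _)) (ns (ww _)) = false

-- degrees: s and each v_i are adjacent to the other n vertices of the clique
-- part plus all d independent vertices; each w_j to s, v_1..v_n.
deg : ∀ {n d} → Vertex n d → ℕ
deg {n} {d} sink = n + d
deg {n} {d} (ns (vv _)) = n + d
deg {n} {d} (ns (ww _)) = suc n

Config : ℕ → ℕ → Set
Config n d = Vec ℕ n × Vec ℕ d

grains : ∀ {n d} → Config n d → NonSink n d → ℕ
grains (cv Data.Product., cw) (vv i) = lookup cv i
grains (cv Data.Product., cw) (ww j) = lookup cw j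

Unstable : ∀ {n d} → Config n d → NonSink n d → Set
Unstable c u = grains c u ≥ deg (ns u)

Stable : ∀ {n d} → Config n d → Set
Stable c = ∀ u → grains c u < deg (ns u)

isSelf : ∀ {n d} → Vertex n d → NonSink n d → Bool
isSelf sink _ = false
isSelf (ns (vv i)) (vv j) = does (i ≟ᶠ j)
isSelf (ns (vv _)) (ww _) = false
isSelf (ns (ww _)) (vv _) = false
isSelf (ns (ww i)) (ww j) = does (i ≟ᶠ j)

newGrains : ∀ {n d} → Vertex n d → Config n d → NonSink n d → ℕ
newGrains x c u =
  ((grains c u) ∸ (if isSelf x u then deg x else 0))
  + (if adj x (ns u) then 1 else 0)

topple : ∀ {n d} → Vertex n d → Config n d → Config n d
topple x c = tabulate (λ i → newGrains x c (vv i)) Data.Product., tabulate (λ j → newGrains x c (ww j))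

allNonSink : (n d : ℕ) → List (NonSink n d)
allNonSink n d = map vv (allFin n) ++ map ww (allFin d)

Valid : ∀ {n d} → Config n d → List (NonSink n d) → Set
Valid c [] = ⊤
Valid c (u ∷ us) = Unstable c u × Valid (topple (ns u) c) us

-- recurrent: stable, and there is an ordering s = u_0, u_1, …, u_{n+d} of all
-- vertices such that toppling u_0,…,u_{i-1} in turn makes u_i unstable.
Recurrent : ∀ {n d} → Config n d → Set
Recurrent {n} {d} c =
  Stable c × Σ (List (NonSink n d)) (λ us → (us ↭ allNonSink n d) × Valid (topple sink c) us)

Decreasing : ∀ {m} → Vec ℕ m → Set
Decreasing {m} x = ∀ (i j : Fin m) → i F.≤ j → lookup x i ≥ lookup x j

Sorted : ∀ {n d} → Config n d → Set
Sorted (cv Data.Product., cw) = Decreasing cv × Decreasing cw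

SortedRecurrent : ∀ {n d} → Config n d → Set
SortedRecurrent c = Sorted c × Recurrent c

{-# OPTIONS --safe #-}
module Submission where

-- Toppling the sink and then the non-sink vertices in some order, a vertex has received one
-- grain from the sink and one from each neighbour toppled before it, so it is unstable at its
-- turn iff it holds at least as many grains as it has neighbours toppled after it.  For a
-- sorted configuration with clique grains a₁ ≥ … ≥ aₙ and independent grains b this turns
-- recurrence into stability plus  (n − i) + #{j | bⱼ ≤ n − i} ≤ aᵢ  for every i.  Necessity:
-- look at the first vertex, in a burning order, among the clique vertices with at most aᵢ grains
-- and the independent ones with at most n − i grains.  Sufficiency: topple wⱼ as soon as at most
-- bⱼ clique vertices remain.
--
-- Relaxing the bounds to aᵢ < e + n + d and bⱼ ≤ e + n, either a₁ is at its bound (drop it: one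
-- clique entry fewer and slack e + 1), or b₁ is (drop it), or neither is and the slack can be
-- lowered to e − 1.  The resulting recursion is solved by
-- |A(x, e, z)| · x! (e + x + 1)! z! = (e + 1) (2x + e + z)!, and for e = 0 the number
-- (2n + d)! / (n! (n + 1)! d!) equals both closed forms.

open import Defs
open import Data.Nat
  using (ℕ; NonZero; zero; suc; pred; _+_; _*_; _∸_; _≟_; _!; _≤_; _<_; _≥_; z≤n; s≤s; _≤?_)
open import Data.Nat.Properties
open import Data.Nat.ListAction using (sum)
open import Data.Nat.Combinatorics using (_C_; nCk≡n!/k![n-k]!; k![n∸k]!∣n!)
open import Data.Nat.DivMod using (m/n*n≡m)
open import Data.Nat.ListAction.Properties using (sum-++; sum-↭)
open import Data.Nat.Tactic.RingSolver using (solve-∀)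
open import Data.Fin using (Fin; zero; suc)
open import Data.Fin.Properties using () renaming (_≟_ to _≟ᶠ_)
open import Data.Vec using (Vec; []; _∷_; lookup; toList)
import Data.Vec.Relation.Unary.All.Properties as VAll
open import Data.Vec.Properties using (lookup∘tabulate; length-toList)
open import Data.List using (List; []; _∷_; length; map; _++_; allFin; tabulate)
open import Data.List.Properties
  using (++-identityʳ; map-++; map-∘; map-tabulate; length-++; length-map; length-tabulate)
open import Data.List.Relation.Unary.All as All using (All; []; _∷_)
import Data.List.Relation.Unary.All.Properties as AllP
open import Data.List.Relation.Unary.Unique.Propositional using (Unique)
open import Data.List.Relation.Unary.AllPairs using (AllPairs; []; _∷_)
import Data.List.Relation.Unary.Unique.Propositional.Properties as Unique
open import Data.List.Membership.Propositional using (_∈_)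
open import Data.List.Membership.Propositional.Properties
  using (∈-map⁺; ∈-map⁻; ∈-++⁺ˡ; ∈-++⁺ʳ; ∈-++⁻)
open import Data.List.Relation.Binary.Disjoint.Propositional using (Disjoint)
open import Data.List.Relation.Unary.Any using (here; there)
open import Data.List.Relation.Binary.Permutation.Propositional
  using (_↭_; prep; ↭-reflexive; ↭-sym; ↭-trans; ↭⇒↭ₛ)
open import Data.List.Relation.Binary.Permutation.Propositional.Properties as ↭ using (↭-length)
open import Data.List.Relation.Binary.Permutation.Setoid.Properties using (Unique-resp-↭)
open import Data.Product using (Σ; _×_; _,_; proj₁; proj₂)
open import Data.Product.Function.NonDependent.Propositional using (_×-⇔_)
open import Data.Unit using (⊤; tt)
open import Data.Empty using (⊥; ⊥-elim)
open import Data.Sum as Sum using (_⊎_; inj₁; inj₂)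
open import Data.Bool using (true; false; if_then_else_)
open import Function using (id; _∘_; _⇔_; mk⇔; Equivalence)
open import Relation.Nullary using (¬_; Dec; does; yes; no)
open import Relation.Nullary.Decidable using (dec-true; dec-false)
open import Relation.Binary.PropositionalEquality hiding ([_])

[_≤_] : ℕ → ℕ → ℕ
[ x ≤ α ] = if does (x ≤? α) then 1 else 0

[≤]-yes : ∀ {x α} → x ≤ α → [ x ≤ α ] ≡ 1
[≤]-yes {x} {α} x≤α = cong (if_then 1 else 0) (dec-true (x ≤? α) x≤α)

[≤]-no : ∀ {x α} → ¬ x ≤ α → [ x ≤ α ] ≡ 0
[≤]-no {x} {α} x≰α = cong (if_then 1 else 0) (dec-false (x ≤? α) x≰α)

[≤]≤1 : ∀ x α → [ x ≤ α ] ≤ 1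
[≤]≤1 x α with does (x ≤? α)
... | true  = ≤-refl
... | false = z≤n

sum-map-mono-≤ : ∀ {A : Set} {f g : A → ℕ} → (∀ x → f x ≤ g x) →
                 ∀ xs → sum (map f xs) ≤ sum (map g xs)
sum-map-mono-≤ f≤g []       = z≤n
sum-map-mono-≤ f≤g (x ∷ xs) = +-mono-≤ (f≤g x) (sum-map-mono-≤ f≤g xs)

sum-map-const : ∀ {A : Set} k (xs : List A) → sum (map (λ _ → k) xs) ≡ length xs * k
sum-map-const k []       = refl
sum-map-const k (x ∷ xs) = cong (k +_) (sum-map-const k xs)

sum-map-≤1 : ∀ {A : Set} {f : A → ℕ} → (∀ x → f x ≤ 1) → ∀ xs → sum (map f xs) ≤ length xs
sum-map-≤1 f≤1 xs =
  ≤-trans (sum-map-mono-≤ f≤1 xs) (≤-reflexive (trans (sum-map-const 1 xs) (*-identityʳ _)))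

count≤ : ℕ → List ℕ → ℕ
count≤ α xs = sum (map (λ x → [ x ≤ α ]) xs)

count≤-≤-length : ∀ α xs → count≤ α xs ≤ length xs
count≤-≤-length α = sum-map-≤1 (λ x → [≤]≤1 x α)

count≤-all : ∀ {α xs} → All (_≤ α) xs → count≤ α xs ≡ length xs
count≤-all []              = refl
count≤-all (x≤α ∷ xs≤α) = cong₂ _+_ ([≤]-yes x≤α) (count≤-all xs≤α)

map-lookup-allFin : ∀ {A : Set} {k} (a : Vec A k) → map (lookup a) (allFin k) ≡ toList a
map-lookup-allFin a = trans (map-tabulate id (lookup a)) (tabulate-lookup a)
  where
  tabulate-lookup : ∀ {k} (a : Vec _ k) → tabulate (lookup a) ≡ toList a
  tabulate-lookup []      = refl
  tabulate-lookup (x ∷ a) = cong (x ∷_) (tabulate-lookup a)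

length-allFin : ∀ k → length (allFin k) ≡ k
length-allFin k = length-tabulate {n = k} id

count≤-lookup : ∀ {k} α (a : Vec ℕ k) →
                sum (map (λ i → [ lookup a i ≤ α ]) (allFin k)) ≡ count≤ α (toList a)
count≤-lookup α a = cong sum (trans (map-∘ (allFin _)) (cong (map _) (map-lookup-allFin a)))

-- Toppling and burning orders

module _ {n d : ℕ} where

  onClique : ℕ → NonSink n d → ℕ
  onClique k (vv _) = k
  onClique k (ww _) = 0

  #clique : List (NonSink n d) → ℕ
  #clique us = sum (map (onClique 1) us)

grains∘topple : ∀ {n d} (x : Vertex n d) c u → grains (topple x c) u ≡ newGrains x c u
grains∘topple x c (vv i) = lookup∘tabulate (λ k → newGrains x c (vv k)) i
grains∘topple x c (ww j) = lookup∘tabulate (λ k → newGrains x c (ww k)) j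

grains-topple : ∀ {n d} (x : Vertex n d) c u → isSelf x u ≡ false →
                grains (topple x c) u ≡ grains c u + (if adj x (ns u) then 1 else 0)
grains-topple x c u notSelf = trans (grains∘topple x c u)
  (cong (λ s → grains c u ∸ (if s then deg x else 0) + (if adj x (ns u) then 1 else 0)) notSelf)

grains-topple-sink : ∀ {n d} (c : Config n d) u → grains (topple sink c) u ≡ grains c u + 1
grains-topple-sink c u = grains-topple sink c u refl

grains-topple-clique : ∀ {n d i} (c : Config n d) u → vv i ≢ u →
                       grains (topple (ns (vv i)) c) u ≡ grains c u + 1
grains-topple-clique {i = i} c (ww j) _ = grains-topple (ns (vv i)) c (ww j) refl
grains-topple-clique {n} {d} {i} c (vv j) i≢j = trans (grains-topple (ns (vv i)) c (vv j) notSelf)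
  (cong (λ s → grains c (vv j) + (if (if s then false else true) then 1 else 0)) notSelf)
  where
  notSelf : isSelf {n} {d} (ns (vv i)) (vv j) ≡ false
  notSelf = dec-false (i ≟ᶠ j) (i≢j ∘ cong vv)

grains-topple-indep : ∀ {n d j} (c : Config n d) u → ww j ≢ u →
                      grains (topple (ns (ww j)) c) u ≡ grains c u + onClique 1 u
grains-topple-indep {j = j} c (vv i) _ = grains-topple (ns (ww j)) c (vv i) refl
grains-topple-indep {j = j} c (ww k) j≢k =
  grains-topple (ns (ww j)) c (ww k) (dec-false (j ≟ᶠ k) (j≢k ∘ cong ww))

-- demand u later: the number of neighbours of u toppled after it.
module _ {n d : ℕ} where

  demand : NonSink n d → List (NonSink n d) → ℕ
  demand (vv _) later = length later
  demand (ww _) later = #clique later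

  BurningOrder : Config n d → List (NonSink n d) → Set
  BurningOrder c []          = ⊤
  BurningOrder c (u ∷ later) = demand u later ≤ grains c u × BurningOrder c later

≤-offset⇔ : ∀ {k s m g g′} → k + s ≡ m → g′ ≡ g + s → (m ≤ g′) ⇔ (k ≤ g)
≤-offset⇔ {k} {s} {g = g} refl refl = mk⇔ (+-cancelʳ-≤ s k g) (+-monoˡ-≤ s)

onClique-suc : ∀ {n d} q (u : NonSink n d) → onClique q u + onClique 1 u ≡ onClique (suc q) u
onClique-suc q (vv _) = +-comm q 1
onClique-suc q (ww _) = refl

-- Each vertex of us has received p grains from the sink and the toppled clique vertices, and
-- each clique vertex of us a further q from the toppled independent vertices.
valid⇔burning : ∀ {n d} (c : Config n d) {us c′} p q → Unique us →
  (∀ {u} → u ∈ us → grains c′ u ≡ grains c u + p + onClique q u) →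
  p + #clique us ≡ suc n → p + q + length us ≡ suc (n + d) →
  Valid c′ us ⇔ BurningOrder c us
valid⇔burning c {[]} p q _ _ _ _ = mk⇔ _ _
valid⇔burning {n} {d} c {vv i ∷ later} {c′} p q (i∉later ∷ unique) received #v len =
  ≤-offset⇔ threshold (trans (received (here refl)) (+-assoc _ p q))
  ×-⇔ valid⇔burning c (suc p) q unique received′ (trans (sym (+-suc p _)) #v)
                                                (trans (sym (+-suc (p + q) _)) len)
  where
  threshold : length later + (p + q) ≡ n + d
  threshold = trans (+-comm _ (p + q)) (suc-injective (trans (sym (+-suc (p + q) _)) len))
  shift : ∀ g p o → g + p + o + 1 ≡ g + suc p + o
  shift = solve-∀
  received′ : ∀ {u} → u ∈ later → grains (topple (ns (vv i)) c′) u ≡ grains c u + suc p + onClique q u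
  received′ {u} u∈later = begin
    grains (topple (ns (vv i)) c′) u   ≡⟨ grains-topple-clique c′ u (All.lookup i∉later u∈later) ⟩
    grains c′ u + 1                    ≡⟨ cong (_+ 1) (received (there u∈later)) ⟩
    grains c u + p + onClique q u + 1  ≡⟨ shift (grains c u) p (onClique q u) ⟩
    grains c u + suc p + onClique q u  ∎
    where open ≡-Reasoning
valid⇔burning {n} {d} c {ww j ∷ later} {c′} p q (j∉later ∷ unique) received #v len =
  ≤-offset⇔ (trans (+-comm _ p) #v) (trans (received (here refl)) (+-identityʳ _))
  ×-⇔ valid⇔burning c p (suc q) unique received′ #v
        (trans (cong (_+ length later) (+-suc p q)) (trans (sym (+-suc (p + q) _)) len))
  where
  received′ : ∀ {u} → u ∈ later → grains (topple (ns (ww j)) c′) u ≡ grains c u + p + onClique (suc q) u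
  received′ {u} u∈later = begin
    grains (topple (ns (ww j)) c′) u
      ≡⟨ grains-topple-indep c′ u (All.lookup j∉later u∈later) ⟩
    grains c′ u + onClique 1 u                        ≡⟨ cong (_+ onClique 1 u) (received (there u∈later)) ⟩
    grains c u + p + onClique q u + onClique 1 u      ≡⟨ +-assoc (grains c u + p) _ _ ⟩
    grains c u + p + (onClique q u + onClique 1 u)    ≡⟨ cong (grains c u + p +_) (onClique-suc q u) ⟩
    grains c u + p + onClique (suc q) u               ∎
    where open ≡-Reasoning

unique-allNonSink : ∀ n d → Unique (allNonSink n d)
unique-allNonSink n d = Unique.++⁺ (Unique.map⁺ vv-injective (Unique.allFin⁺ n))
                                   (Unique.map⁺ ww-injective (Unique.allFin⁺ d)) disjoint
  where
  vv-injective : ∀ {i j} → vv {n} {d} i ≡ vv j → i ≡ j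
  vv-injective refl = refl
  ww-injective : ∀ {i j} → ww {n} {d} i ≡ ww j → i ≡ j
  ww-injective refl = refl
  disjoint : ∀ {u} → ¬ (u ∈ map vv (allFin n) × u ∈ map ww (allFin d))
  disjoint (u∈vs , u∈ws) with ∈-map⁻ vv u∈vs | ∈-map⁻ ww u∈ws
  ... | _ , _ , refl | _ , _ , ()

module Split {n d} {us : List (NonSink n d)} (is : List (Fin n)) (js : List (Fin d))
             (us↭ : us ↭ map vv is ++ map ww js) where

  sum≡ : ∀ f → sum (map f us) ≡ sum (map (f ∘ vv) is) + sum (map (f ∘ ww) js)
  sum≡ f = begin
    sum (map f us)                                        ≡⟨ sum-↭ (↭.map⁺ f us↭) ⟩
    sum (map f (map vv is ++ map ww js))                  ≡⟨ cong sum (map-++ f (map vv is) (map ww js)) ⟩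
    sum (map f (map vv is) ++ map f (map ww js))          ≡⟨ sum-++ (map f (map vv is)) (map f (map ww js)) ⟩
    sum (map f (map vv is)) + sum (map f (map ww js))
      ≡⟨ cong₂ _+_ (cong sum (map-∘ is)) (cong sum (map-∘ js)) ⟨
    sum (map (f ∘ vv) is) + sum (map (f ∘ ww) js)         ∎
    where open ≡-Reasoning

  length≡ : length us ≡ length is + length js
  length≡ = trans (↭-length us↭)
    (trans (length-++ (map vv is)) (cong₂ _+_ (length-map vv is) (length-map ww js)))

  #clique≡ : #clique us ≡ length is
  #clique≡ = begin
    #clique us
      ≡⟨ sum≡ (onClique 1) ⟩
    sum (map (λ _ → 1) is) + sum (map (λ _ → 0) js)
      ≡⟨ cong₂ _+_ (sum-map-const 1 is) (sum-map-const 0 js) ⟩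
    length is * 1 + length js * 0
      ≡⟨ cong₂ _+_ (*-identityʳ (length is)) (*-zeroʳ (length js)) ⟩
    length is + 0
      ≡⟨ +-identityʳ (length is) ⟩
    length is                                     ∎
    where open ≡-Reasoning

valid⇔burning-after-sink : ∀ {n d} {us : List (NonSink n d)} → us ↭ allNonSink n d →
                           (c : Config n d) → Valid (topple sink c) us ⇔ BurningOrder c us
valid⇔burning-after-sink {n} {d} {us} us↭all c =
  valid⇔burning c 1 0 unique received (cong suc (trans #clique≡ (length-allFin n)))
                                      (cong suc (trans length≡ (cong₂ _+_ (length-allFin n) (length-allFin d))))
  where
  open Split (allFin n) (allFin d) us↭all
  unique : Unique us
  unique = Unique-resp-↭ (setoid (NonSink n d)) (↭⇒↭ₛ (↭-sym us↭all)) (unique-allNonSink n d)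
  received : ∀ {u} → u ∈ _ → grains (topple sink c) u ≡ grains c u + 1 + onClique 0 u
  received {vv i} _ = trans (grains-topple-sink c (vv i)) (sym (+-identityʳ _))
  received {ww j} _ = trans (grains-topple-sink c (ww j)) (sym (+-identityʳ _))

Criterion : List ℕ → List ℕ → Set
Criterion B []      = ⊤
Criterion B (h ∷ A) = length A + count≤ (length A) B ≤ h × Criterion B A

LowSetBound : List ℕ → List ℕ → Set
LowSetBound A B = ∀ α t → 1 ≤ count≤ α A + count≤ t B →
                  count≤ α A + count≤ t B ≤ suc α ⊎ count≤ α A ≤ t

lowSetBound⇒criterion : ∀ {A B} → AllPairs _≥_ A → LowSetBound A B → Criterion B A
lowSetBound⇒criterion {[]}    _ _ = tt
lowSetBound⇒criterion {h ∷ A} {B} (A≤h ∷ sorted) bound =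
  head-bound , lowSetBound⇒criterion sorted tail-bound
  where
  m : ℕ
  m = length A
  count-h : count≤ h (h ∷ A) ≡ suc m
  count-h = count≤-all (≤-refl ∷ A≤h)
  head-bound : m + count≤ m B ≤ h
  head-bound with bound h m (subst (λ k → 1 ≤ k + count≤ m B) (sym count-h) (s≤s z≤n))
  ... | inj₁ fits    = ≤-pred (subst (λ k → k + count≤ m B ≤ suc h) count-h fits)
  ... | inj₂ too-few = ⊥-elim (1+n≰n (subst (_≤ m) count-h too-few))
  tail-bound : LowSetBound A B
  tail-bound α t pos with bound α t (≤-trans pos (+-monoˡ-≤ (count≤ t B) (m≤n+m _ _)))
  ... | inj₁ fits     = inj₁ (≤-trans (+-monoˡ-≤ (count≤ t B) (m≤n+m _ [ h ≤ α ])) fits)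
  ... | inj₂ bounded  = inj₂ (≤-trans (m≤n+m _ [ h ≤ α ]) bounded)

module Necessity {n d} (a : Vec ℕ n) (b : Vec ℕ d) where

  lowClique : ℕ → NonSink n d → ℕ
  lowClique α (vv i) = [ lookup a i ≤ α ]
  lowClique α (ww _) = 0

  low : ℕ → ℕ → NonSink n d → ℕ
  low α t (vv i) = [ lookup a i ≤ α ]
  low α t (ww j) = [ lookup b j ≤ t ]

  #low : ℕ → ℕ → List (NonSink n d) → ℕ
  #low α t us = sum (map (low α t) us)

  #lowClique : ℕ → List (NonSink n d) → ℕ
  #lowClique α us = sum (map (lowClique α) us)

  -- The first low vertex of a burning order has all other low vertices after it if it is a
  -- clique vertex, and all low clique vertices after it otherwise.
  burning⇒low-bound : ∀ {us} → BurningOrder (a , b) us → ∀ α t →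
                      1 ≤ #low α t us → #low α t us ≤ suc α ⊎ #lowClique α us ≤ t
  burning⇒low-bound {vv i ∷ later} (demand≤ , burning) α t pos with lookup a i ≤? α
  ... | yes aᵢ≤α = inj₁ (subst (_≤ suc α) (cong (_+ #low α t later) (sym ([≤]-yes aᵢ≤α)))
                          (s≤s (≤-trans (sum-map-≤1 low≤1 later) (≤-trans demand≤ aᵢ≤α))))
    where
    low≤1 : ∀ u → low α t u ≤ 1
    low≤1 (vv i) = [≤]≤1 (lookup a i) α
    low≤1 (ww j) = [≤]≤1 (lookup b j) t
  ... | no aᵢ≰α = Sum.map (subst (_≤ suc α) (sym skip)) (subst (_≤ t) (sym skip))
                          (burning⇒low-bound burning α t (subst (1 ≤_) skip pos))
    where
    skip : ∀ {k} → [ lookup a i ≤ α ] + k ≡ k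
    skip = cong (_+ _) ([≤]-no aᵢ≰α)
  burning⇒low-bound {ww j ∷ later} (demand≤ , burning) α t pos with lookup b j ≤? t
  ... | yes bⱼ≤t = inj₂ (≤-trans (sum-map-mono-≤ lowClique≤onClique later) (≤-trans demand≤ bⱼ≤t))
    where
    lowClique≤onClique : ∀ u → lowClique α u ≤ onClique 1 u
    lowClique≤onClique (vv i) = [≤]≤1 (lookup a i) α
    lowClique≤onClique (ww j) = z≤n
  ... | no bⱼ≰t = Sum.map (subst (_≤ suc α) (sym skip)) id
                          (burning⇒low-bound burning α t (subst (1 ≤_) skip pos))
    where
    skip : [ lookup b j ≤ t ] + #low α t later ≡ #low α t later
    skip = cong (_+ _) ([≤]-no bⱼ≰t)

  burning⇒criterion : ∀ {us} → us ↭ allNonSink n d → BurningOrder (a , b) us →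
                      AllPairs _≥_ (toList a) → Criterion (toList b) (toList a)
  burning⇒criterion {us} us↭all burning a-sorted = lowSetBound⇒criterion a-sorted bound
    where
    open Split (allFin n) (allFin d) us↭all
    #low≡ : ∀ α t → #low α t us ≡ count≤ α (toList a) + count≤ t (toList b)
    #low≡ α t = trans (sum≡ (low α t)) (cong₂ _+_ (count≤-lookup α a) (count≤-lookup t b))
    #lowClique≡ : ∀ α → #lowClique α us ≡ count≤ α (toList a)
    #lowClique≡ α = trans (sum≡ (lowClique α))
      (trans (cong₂ _+_ (count≤-lookup α a) (trans (sum-map-const 0 (allFin d)) (*-zeroʳ (length (allFin d)))))
             (+-identityʳ _))
    bound : LowSetBound (toList a) (toList b)
    bound α t pos = subst₂ (λ L P → L ≤ suc α ⊎ P ≤ t) (#low≡ α t) (#lowClique≡ α)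
                      (burning⇒low-bound burning α t (subst (1 ≤_) (sym (#low≡ α t)) pos))

criterion-cong : ∀ {B B′} A → (∀ m → m < length A → count≤ m B ≡ count≤ m B′) →
                 Criterion B A → Criterion B′ A
criterion-cong []      _    _             = tt
criterion-cong (h ∷ A) same (head , rest) =
  subst (λ k → length A + k ≤ h) (same (length A) ≤-refl) head ,
  criterion-cong A (λ m m<A → same m (m<n⇒m<1+n m<A)) rest

criterion-drop-large : ∀ {g B} A → length A ≤ g → Criterion (g ∷ B) A ⇔ Criterion B A
criterion-drop-large {g} {B} A A≤g =
  mk⇔ (criterion-cong A drop) (criterion-cong A (λ m m<A → sym (drop m m<A)))
  where
  drop : ∀ m → m < length A → count≤ m (g ∷ B) ≡ count≤ m B
  drop m m<A = cong (_+ _) ([≤]-no (<⇒≱ (<-≤-trans m<A A≤g)))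

module Sufficiency {n d} (a : Vec ℕ n) (b : Vec ℕ d) where

  mutual
    interleave : List (Fin n) → List (Fin d) → List (NonSink n d)
    interleave is []       = map vv is
    interleave is (j ∷ js) = placeIndep j js is

    placeIndep : Fin d → List (Fin d) → List (Fin n) → List (NonSink n d)
    placeIndep j js []       = ww j ∷ interleave [] js
    placeIndep j js (i ∷ is) with length (i ∷ is) ≤? lookup b j
    ... | yes _ = ww j ∷ interleave (i ∷ is) js
    ... | no _  = vv i ∷ placeIndep j js is

  mutual
    interleave-↭ : ∀ is js → interleave is js ↭ map vv is ++ map ww js
    interleave-↭ is []       = ↭-reflexive (sym (++-identityʳ _))
    interleave-↭ is (j ∷ js) = placeIndep-↭ j js is

    placeIndep-↭ : ∀ j js is → placeIndep j js is ↭ map vv is ++ map ww (j ∷ js)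
    placeIndep-↭ j js []       = prep (ww j) (interleave-↭ [] js)
    placeIndep-↭ j js (i ∷ is) with length (i ∷ is) ≤? lookup b j
    ... | yes _ = ↭-trans (prep (ww j) (interleave-↭ (i ∷ is) js))
                          (↭-sym (↭.shift (ww j) (map vv (i ∷ is)) (map ww js)))
    ... | no _  = prep (vv i) (placeIndep-↭ j js is)

  burns-map-vv : ∀ is → Criterion [] (map (lookup a) is) → BurningOrder (a , b) (map vv is)
  burns-map-vv []       _             = tt
  burns-map-vv (i ∷ is) (head , rest) =
    subst (_≤ lookup a i)
      (trans (+-identityʳ _) (trans (length-map (lookup a) is) (sym (length-map vv is)))) head ,
    burns-map-vv is rest

  mutual
    interleave-burns : ∀ is js → AllPairs _≥_ (map (lookup b) js) →
                       Criterion (map (lookup b) js) (map (lookup a) is) →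
                       BurningOrder (a , b) (interleave is js)
    interleave-burns is []       _      criterion = burns-map-vv is criterion
    interleave-burns is (j ∷ js) sorted criterion = placeIndep-burns j js is sorted criterion

    placeIndep-burns : ∀ j js is → AllPairs _≥_ (map (lookup b) (j ∷ js)) →
                       Criterion (map (lookup b) (j ∷ js)) (map (lookup a) is) →
                       BurningOrder (a , b) (placeIndep j js is)
    placeIndep-burns j js [] (_ ∷ sorted) _ =
      subst (_≤ lookup b j) (sym (Split.#clique≡ [] js (interleave-↭ [] js))) z≤n ,
      interleave-burns [] js sorted tt
    placeIndep-burns j js (i ∷ is) (B≤bⱼ ∷ sorted) criterion with length (i ∷ is) ≤? lookup b j
    ... | yes is≤bⱼ = subst (_≤ lookup b j)
                        (sym (Split.#clique≡ (i ∷ is) js (interleave-↭ (i ∷ is) js))) is≤bⱼ ,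
                      interleave-burns (i ∷ is) js sorted
                        (Equivalence.to (criterion-drop-large A A≤bⱼ) criterion)
      where
      A : List ℕ
      A = map (lookup a) (i ∷ is)
      A≤bⱼ : length A ≤ lookup b j
      A≤bⱼ = subst (_≤ lookup b j) (sym (length-map (lookup a) (i ∷ is))) is≤bⱼ
    ... | no is≰bⱼ = subst (_≤ lookup a i) demand≡ (proj₁ criterion) ,
                     placeIndep-burns j js is (B≤bⱼ ∷ sorted) (proj₂ criterion)
      where
      m : ℕ
      m = length (map (lookup a) is)
      bⱼ≤m : lookup b j ≤ m
      bⱼ≤m = subst (lookup b j ≤_) (sym (length-map (lookup a) is)) (≤-pred (≰⇒> is≰bⱼ))
      demand≡ : m + count≤ m (map (lookup b) (j ∷ js)) ≡ length (placeIndep j js is)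
      demand≡ = begin
        m + count≤ m (map (lookup b) (j ∷ js))
          ≡⟨ cong (m +_) (count≤-all (bⱼ≤m ∷ All.map (λ b≤bⱼ → ≤-trans b≤bⱼ bⱼ≤m) B≤bⱼ)) ⟩
        m + length (map (lookup b) (j ∷ js))
          ≡⟨ cong₂ _+_ (length-map (lookup a) is) (length-map (lookup b) (j ∷ js)) ⟩
        length is + length (j ∷ js)
          ≡⟨ Split.length≡ is (j ∷ js) (placeIndep-↭ j js is) ⟨
        length (placeIndep j js is)
          ∎
        where open ≡-Reasoning

  criterion⇒burning : AllPairs _≥_ (toList b) → Criterion (toList b) (toList a) →
                      Σ (List (NonSink n d)) λ us → us ↭ allNonSink n d × BurningOrder (a , b) us
  criterion⇒burning b-sorted criterion =
    interleave (allFin n) (allFin d) , interleave-↭ (allFin n) (allFin d) ,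
    interleave-burns (allFin n) (allFin d) (subst (AllPairs _≥_) (sym (map-lookup-allFin b)) b-sorted)
      (subst₂ Criterion (sym (map-lookup-allFin b)) (sym (map-lookup-allFin a)) criterion)

decreasing⇒allPairs : ∀ {m} (v : Vec ℕ m) → Decreasing v → AllPairs _≥_ (toList v)
decreasing⇒allPairs []      _   = []
decreasing⇒allPairs (h ∷ t) dec =
  VAll.toList⁺ (VAll.lookup⁻ (λ j → dec zero (suc j) z≤n)) ∷
  decreasing⇒allPairs t (λ i j i≤j → dec (suc i) (suc j) (s≤s i≤j))

allPairs⇒decreasing : ∀ {m} (v : Vec ℕ m) → AllPairs _≥_ (toList v) → Decreasing v
allPairs⇒decreasing (h ∷ t) (h≥t ∷ sorted) zero    zero    _         = ≤-refl
allPairs⇒decreasing (h ∷ t) (h≥t ∷ sorted) zero    (suc j) _         = VAll.lookup⁺ (VAll.toList⁻ h≥t) j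
allPairs⇒decreasing (h ∷ t) (h≥t ∷ sorted) (suc i) (suc j) (s≤s i≤j) =
  allPairs⇒decreasing t sorted i j i≤j

record Admissible (N s : ℕ) {x z : ℕ} (c : Config x z) : Set where
  constructor admissible
  field
    clique-sorted : AllPairs _≥_ (toList (proj₁ c))
    indep-sorted  : AllPairs _≥_ (toList (proj₂ c))
    clique-bound  : All (_< N) (toList (proj₁ c))
    indep-bound   : All (_≤ s) (toList (proj₂ c))
    criterion     : Criterion (toList (proj₂ c)) (toList (proj₁ c))

sortedRecurrent⇔admissible : ∀ {n d} (c : Config n d) → SortedRecurrent c ⇔ Admissible (n + d) n c
sortedRecurrent⇔admissible {n} {d} c@(a , b) = mk⇔ to from
  where
  to : SortedRecurrent c → Admissible (n + d) n c
  to ((a-dec , b-dec) , stable , us , us↭all , valid) = admissible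
    a-sorted (decreasing⇒allPairs b b-dec)
    (VAll.toList⁺ (VAll.lookup⁻ (λ i → stable (vv i))))
    (VAll.toList⁺ (VAll.lookup⁻ (λ j → ≤-pred (stable (ww j)))))
    (Necessity.burning⇒criterion a b us↭all
      (Equivalence.to (valid⇔burning-after-sink us↭all c) valid) a-sorted)
    where
    a-sorted : AllPairs _≥_ (toList a)
    a-sorted = decreasing⇒allPairs a a-dec
  from : Admissible (n + d) n c → SortedRecurrent c
  from (admissible a-sorted b-sorted a-bound b-bound criterion)
    with us , us↭all , burning ← Sufficiency.criterion⇒burning a b b-sorted criterion =
    (allPairs⇒decreasing a a-sorted , allPairs⇒decreasing b b-sorted) , stable ,
    us , us↭all , Equivalence.from (valid⇔burning-after-sink us↭all c) burning
    where
    stable : Stable c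
    stable (vv i) = VAll.lookup⁺ (VAll.toList⁻ a-bound) i
    stable (ww j) = s≤s (VAll.lookup⁺ (VAll.toList⁻ b-bound) j)

-- Enumerating admissible configurations

HeadIs : ∀ {k} → ℕ → Vec ℕ k → Set
HeadIs m []      = ⊥
HeadIs m (h ∷ _) = h ≡ m

headIs? : ∀ {k} m (v : Vec ℕ k) → Dec (HeadIs m v)
headIs? m []      = no id
headIs? m (h ∷ _) = h ≟ m

module _ {N s x z : ℕ} where

  admissible-weaken : ∀ {N′ s′} {c : Config x z} → N ≤ N′ → s ≤ s′ →
                      Admissible N s c → Admissible N′ s′ c
  admissible-weaken N≤N′ s≤s′ (admissible a-sorted b-sorted a-bound b-bound criterion) =
    admissible a-sorted b-sorted (All.map (λ v<N → <-≤-trans v<N N≤N′) a-bound)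
                                 (All.map (λ v≤s → ≤-trans v≤s s≤s′) b-bound) criterion

  admissible-consTop : ∀ {a : Vec ℕ x} {b : Vec ℕ z} → x + z < N →
                       Admissible N s (a , b) → Admissible N s (pred N ∷ a , b)
  admissible-consTop {a} {b} (s≤s x+z≤M) (admissible a-sorted b-sorted a-bound b-bound criterion) =
    admissible (All.map ≤-pred a-bound ∷ a-sorted) b-sorted (≤-refl ∷ a-bound) b-bound (head , criterion)
    where
    head : length (toList a) + count≤ (length (toList a)) (toList b) ≤ _
    head rewrite length-toList a =
      ≤-trans (+-monoʳ-≤ x (≤-trans (count≤-≤-length x (toList b)) (≤-reflexive (length-toList b))))
              x+z≤M

  admissible-consIndep : ∀ {a : Vec ℕ x} {b : Vec ℕ z} → x ≤ s →
                         Admissible N s (a , b) → Admissible N s (a , s ∷ b)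
  admissible-consIndep {a} x≤s (admissible a-sorted b-sorted a-bound b-bound criterion) =
    admissible a-sorted (b-bound ∷ b-sorted) a-bound (≤-refl ∷ b-bound)
      (Equivalence.from (criterion-drop-large (toList a) (subst (_≤ s) (sym (length-toList a)) x≤s)) criterion)

  admissible-tailIndep : ∀ {a : Vec ℕ x} {g} {b : Vec ℕ z} → x ≤ g →
                         Admissible N s (a , g ∷ b) → Admissible N s (a , b)
  admissible-tailIndep {a} x≤g (admissible a-sorted (_ ∷ b-sorted) a-bound (_ ∷ b-bound) criterion) =
    admissible a-sorted b-sorted a-bound b-bound
      (Equivalence.to (criterion-drop-large (toList a) (subst (_≤ _) (sym (length-toList a)) x≤g)) criterion)

  admissible⇒¬topClique : ∀ {a : Vec ℕ x} {b : Vec ℕ z} → Admissible N s (a , b) → ¬ HeadIs N a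
  admissible⇒¬topClique {h ∷ _} (admissible _ _ (h<N ∷ _) _ _) refl = <-irrefl refl h<N

  admissible⇒¬topIndep : ∀ {a : Vec ℕ x} {b : Vec ℕ z} → Admissible N s (a , b) → ¬ HeadIs (suc s) b
  admissible⇒¬topIndep {b = g ∷ _} (admissible _ _ _ (g≤s ∷ _) _) refl = 1+n≰n g≤s

admissible-tailClique : ∀ {N s x z h a b} → Admissible N s {suc x} {z} (h ∷ a , b) → Admissible N s (a , b)
admissible-tailClique (admissible (_ ∷ a-sorted) b-sorted (_ ∷ a-bound) b-bound (_ , criterion)) =
  admissible a-sorted b-sorted a-bound b-bound criterion

admissible-lowerClique : ∀ {M s x z} {a : Vec ℕ x} {b : Vec ℕ z} → ¬ HeadIs M a →
                         Admissible (suc M) s (a , b) → Admissible M s (a , b)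
admissible-lowerClique {a = []}    _ (admissible a-sorted b-sorted [] b-bound criterion) =
  admissible a-sorted b-sorted [] b-bound criterion
admissible-lowerClique {M} {a = h ∷ a} h≢M
  (admissible a-sorted@(a≤h ∷ _) b-sorted (h<1+M ∷ _) b-bound criterion) =
  admissible a-sorted b-sorted (h<M ∷ All.map (λ v≤h → ≤-<-trans v≤h h<M) a≤h) b-bound criterion
  where
  h<M : h < M
  h<M = ≤∧≢⇒< (≤-pred h<1+M) h≢M

admissible-lowerIndep : ∀ {N s x z} {a : Vec ℕ x} {b : Vec ℕ z} → ¬ HeadIs (suc s) b →
                        Admissible N (suc s) (a , b) → Admissible N s (a , b)
admissible-lowerIndep {b = []}    _ (admissible a-sorted b-sorted a-bound [] criterion) =
  admissible a-sorted b-sorted a-bound [] criterion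
admissible-lowerIndep {s = s} {b = g ∷ b} g≢1+s
  (admissible a-sorted b-sorted@(b≤g ∷ _) a-bound (g≤1+s ∷ _) criterion) =
  admissible a-sorted b-sorted a-bound (g≤s ∷ All.map (λ v≤g → ≤-trans v≤g g≤s) b≤g) criterion
  where
  g≤s : g ≤ s
  g≤s = ≤-pred (≤∧≢⇒< g≤1+s g≢1+s)

admissible-no-room : ∀ {x z h} {a : Vec ℕ x} {b : Vec ℕ z} → ¬ Admissible (x + z) x (h ∷ a , b)
admissible-no-room {x} {z} {h} {a} {b} (admissible _ _ (h<x+z ∷ _) b-bound (head , _)) =
  <⇒≱ h<x+z (subst (_≤ h) x+z≡ head)
  where
  x+z≡ : length (toList a) + count≤ (length (toList a)) (toList b) ≡ x + z
  x+z≡ rewrite length-toList a = cong (x +_) (trans (count≤-all b-bound) (length-toList b))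

consClique : ∀ {x z} → ℕ → Config x z → Config (suc x) z
consClique h (a , b) = h ∷ a , b

consIndep : ∀ {x z} → ℕ → Config x z → Config x (suc z)
consIndep g (a , b) = a , g ∷ b

-- admissibles x e z lists the configurations that are Admissible (e + x + z) (e + x), split by
-- whether the first clique entry is at its bound, the first independent entry is at its bound,
-- or neither (and then the slack e is positive).
base : (x e z : ℕ) → List (Config x z)
base zero    zero    zero    = ([] , []) ∷ []
base zero    zero    (suc z) = []
base zero    (suc e) z       = []
base (suc x) e       z       = []

mutual
  admissibles : (x e z : ℕ) → List (Config x z)
  admissibles x e z = base x e z ++ topClique x e z ++ noTop x e z ++ topIndep x e z

  topClique : (x e z : ℕ) → List (Config x z)
  topClique zero    e z = []
  topClique (suc x) e z = map (consClique (pred (e + suc x + z))) (admissibles x (suc e) z)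

  noTop : (x e z : ℕ) → List (Config x z)
  noTop x zero    z = []
  noTop x (suc e) z = admissibles x e z

  topIndep : (x e z : ℕ) → List (Config x z)
  topIndep x e zero    = []
  topIndep x e (suc z) = map (consIndep (e + x)) (admissibles x e z)

shift-bounds : ∀ {e x z} {c : Config x z} →
               Admissible (suc e + x + z) (suc e + x) c ⇔ Admissible (e + suc x + z) (e + suc x) c
shift-bounds {e} {x} {z} {c} = mk⇔ (subst₂ (λ N s → Admissible N s c) (cong (_+ z) eq) eq)
                                    (subst₂ (λ N s → Admissible N s c) (cong (_+ z) (sym eq)) (sym eq))
  where
  eq : suc e + x ≡ e + suc x
  eq = sym (+-suc e x)

mutual
  admissibles-sound : ∀ x e z → All (Admissible (e + x + z) (e + x)) (admissibles x e z)
  admissibles-sound x e z =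
    AllP.++⁺ (base-sound x e z)
      (AllP.++⁺ (topClique-sound x e z) (AllP.++⁺ (noTop-sound x e z) (topIndep-sound x e z)))

  base-sound : ∀ x e z → All (Admissible (e + x + z) (e + x)) (base x e z)
  base-sound zero    zero    zero    = admissible [] [] [] [] tt ∷ []
  base-sound zero    zero    (suc z) = []
  base-sound zero    (suc e) z       = []
  base-sound (suc x) e       z       = []

  topClique-sound : ∀ x e z → All (Admissible (e + x + z) (e + x)) (topClique x e z)
  topClique-sound zero    e z = []
  topClique-sound (suc x) e z = AllP.map⁺ (All.map
    (admissible-consTop (+-monoˡ-≤ z (m≤n+m (suc x) e)) ∘ Equivalence.to shift-bounds)
    (admissibles-sound x (suc e) z))

  noTop-sound : ∀ x e z → All (Admissible (e + x + z) (e + x)) (noTop x e z)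
  noTop-sound x zero    z = []
  noTop-sound x (suc e) z = All.map (admissible-weaken (n≤1+n _) (n≤1+n _)) (admissibles-sound x e z)

  topIndep-sound : ∀ x e z → All (Admissible (e + x + z) (e + x)) (topIndep x e z)
  topIndep-sound x e zero    = []
  topIndep-sound x e (suc z) = AllP.map⁺ (All.map
    (admissible-weaken (+-monoʳ-≤ (e + x) (n≤1+n z)) ≤-refl ∘ admissible-consIndep (m≤n+m x e))
    (admissibles-sound x e z))

mutual
  admissibles-complete : ∀ x e z (c : Config x z) → Admissible (e + x + z) (e + x) c → c ∈ admissibles x e z
  admissibles-complete x e z c@(a , b) adm with headIs? (pred (e + x + z)) a | headIs? (e + x) b
  ... | yes topA | _       = ∈-++⁺ʳ (base x e z) (∈-++⁺ˡ (∈-topClique x e z a b topA adm))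
  ... | no ¬topA | yes topB =
    ∈-++⁺ʳ (base x e z) (∈-++⁺ʳ (topClique x e z) (∈-++⁺ʳ (noTop x e z)
      (∈-topIndep x e z a b ¬topA topB adm)))
  ... | no ¬topA | no ¬topB = ∈-base-or-noTop x e z a b ¬topA ¬topB adm

  ∈-topClique : ∀ x e z a b → HeadIs (pred (e + x + z)) a → Admissible (e + x + z) (e + x) (a , b) →
                (a , b) ∈ topClique x e z
  ∈-topClique (suc x) e z (_ ∷ a) b refl adm =
    ∈-map⁺ (consClique _) (admissibles-complete x (suc e) z (a , b)
      (Equivalence.from shift-bounds (admissible-tailClique adm)))

  ∈-topIndep : ∀ x e z a b → ¬ HeadIs (pred (e + x + z)) a → HeadIs (e + x) b →
               Admissible (e + x + z) (e + x) (a , b) → (a , b) ∈ topIndep x e z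
  ∈-topIndep x e (suc z) a (_ ∷ b) ¬topA refl adm =
    ∈-map⁺ (consIndep _) (admissibles-complete x e z (a , b)
      (admissible-lowerClique (¬topA ∘ subst (λ m → HeadIs m a) (cong pred (sym (+-suc (e + x) z))))
        (subst (λ N → Admissible N (e + x) (a , b)) (+-suc (e + x) z) (admissible-tailIndep (m≤n+m x e) adm))))

  ∈-base-or-noTop : ∀ x e z a b → ¬ HeadIs (pred (e + x + z)) a → ¬ HeadIs (e + x) b →
                    Admissible (e + x + z) (e + x) (a , b) → (a , b) ∈ admissibles x e z
  ∈-base-or-noTop x (suc e) z a b ¬topA ¬topB adm =
    ∈-++⁺ʳ (base x (suc e) z) (∈-++⁺ʳ (topClique x (suc e) z) (∈-++⁺ˡ
      (admissibles-complete x e z (a , b) (admissible-lowerClique ¬topA (admissible-lowerIndep ¬topB adm)))))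
  ∈-base-or-noTop zero    zero zero    [] []      _    _    _   = here refl
  ∈-base-or-noTop zero    zero (suc z) [] (g ∷ b) _    ¬topB adm =
    ⊥-elim (¬topB (n≤0⇒n≡0 (All.head (Admissible.indep-bound adm))))
  ∈-base-or-noTop (suc x) zero z       (h ∷ a) b ¬topA ¬topB adm =
    ⊥-elim (admissible-no-room (admissible-lowerClique ¬topA (admissible-lowerIndep ¬topB adm)))

topClique-top : ∀ x e z {c} → c ∈ topClique x e z → HeadIs (pred (e + x + z)) (proj₁ c)
topClique-top (suc x) e z c∈ with ∈-map⁻ (consClique _) c∈
... | _ , _ , refl = refl

topIndep-top : ∀ x e z {c} → c ∈ topIndep x e z → HeadIs (e + x) (proj₂ c)
topIndep-top x e (suc z) c∈ with ∈-map⁻ (consIndep _) c∈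
... | _ , _ , refl = refl

noTop-¬top : ∀ x e z {c} → c ∈ noTop x e z →
             ¬ HeadIs (pred (e + x + z)) (proj₁ c) × ¬ HeadIs (e + x) (proj₂ c)
noTop-¬top x (suc e) z {c} c∈ = admissible⇒¬topClique adm , admissible⇒¬topIndep adm
  where
  adm : Admissible (e + x + z) (e + x) c
  adm = All.lookup (admissibles-sound x e z) c∈

topIndep-¬topClique : ∀ x e z {c} → c ∈ topIndep x e z → ¬ HeadIs (pred (e + x + z)) (proj₁ c)
topIndep-¬topClique x e (suc z) c∈ with ∈-map⁻ (consIndep _) c∈
... | (a , b) , c′∈ , refl = admissible⇒¬topClique (All.lookup (admissibles-sound x e z) c′∈)
                           ∘ subst (λ m → HeadIs m a) (cong pred (+-suc (e + x) z))

mutual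
  admissibles-unique : ∀ x e z → Unique (admissibles x e z)
  admissibles-unique x e z =
    Unique.++⁺ (base-unique x e z)
      (Unique.++⁺ (topClique-unique x e z)
                  (Unique.++⁺ (noTop-unique x e z) (topIndep-unique x e z) noTop#topIndep)
                  topClique#rest)
      (base#rest x e z)
    where
    noTop#topIndep : Disjoint (noTop x e z) (topIndep x e z)
    noTop#topIndep (c∈noTop , c∈topIndep) =
      proj₂ (noTop-¬top x e z c∈noTop) (topIndep-top x e z c∈topIndep)
    topClique#rest : Disjoint (topClique x e z) (noTop x e z ++ topIndep x e z)
    topClique#rest (c∈topClique , c∈rest) with ∈-++⁻ (noTop x e z) c∈rest
    ... | inj₁ c∈noTop    = proj₁ (noTop-¬top x e z c∈noTop) (topClique-top x e z c∈topClique)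
    ... | inj₂ c∈topIndep = topIndep-¬topClique x e z c∈topIndep (topClique-top x e z c∈topClique)

  base-unique : ∀ x e z → Unique (base x e z)
  base-unique zero    zero    zero    = [] ∷ []
  base-unique zero    zero    (suc z) = []
  base-unique zero    (suc e) z       = []
  base-unique (suc x) e       z       = []

  base#rest : ∀ x e z → Disjoint (base x e z) (topClique x e z ++ noTop x e z ++ topIndep x e z)
  base#rest zero    zero    zero    (_ , ())
  base#rest zero    zero    (suc z) (() , _)
  base#rest zero    (suc e) z       (() , _)
  base#rest (suc x) e       z       (() , _)

  topClique-unique : ∀ x e z → Unique (topClique x e z)
  topClique-unique zero    e z = []
  topClique-unique (suc x) e z = Unique.map⁺ consClique-injective (admissibles-unique x (suc e) z)
    where
    consClique-injective : ∀ {h} {c c′ : Config x z} → consClique h c ≡ consClique h c′ → c ≡ c′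
    consClique-injective refl = refl

  noTop-unique : ∀ x e z → Unique (noTop x e z)
  noTop-unique x zero    z = []
  noTop-unique x (suc e) z = admissibles-unique x e z

  topIndep-unique : ∀ x e z → Unique (topIndep x e z)
  topIndep-unique x e zero    = []
  topIndep-unique x e (suc z) = Unique.map⁺ consIndep-injective (admissibles-unique x e z)
    where
    consIndep-injective : ∀ {g} {c c′ : Config x z} → consIndep g c ≡ consIndep g c′ → c ≡ c′
    consIndep-injective refl = refl

-- Counting

weight : (x e z : ℕ) → ℕ
weight x e z = x ! * suc (e + x) ! * z !

-- 2 * x + e + z is a successor by computation outside the base case, so the K of
-- length-nonbase is found by refl.
mutual
  length-admissibles : ∀ x e z → length (admissibles x e z) * weight x e z ≡ suc e * (2 * x + e + z) !
  length-admissibles zero    zero    zero    = refl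
  length-admissibles (suc x) e       z       = length-nonbase (suc x) e z refl
  length-admissibles zero    (suc e) z       = length-nonbase zero (suc e) z refl
  length-admissibles zero    zero    (suc z) = length-nonbase zero zero (suc z) refl

  length-nonbase : ∀ x e z {K} → 2 * x + e + z ≡ suc K →
    length (topClique x e z ++ noTop x e z ++ topIndep x e z) * weight x e z ≡ suc e * suc K !
  length-nonbase x e z {K} total = begin
    length (T ++ V ++ I) * weight x e z
      ≡⟨ cong (_* weight x e z) split ⟩
    (length T + (length V + length I)) * weight x e z
      ≡⟨ distrib (length T) (length V) (length I) (weight x e z) ⟩
    length T * weight x e z + (length V * weight x e z + length I * weight x e z)
      ≡⟨ cong₂ _+_ (length-topClique x e z total)
                   (cong₂ _+_ (length-noTop x e z total) (length-topIndep x e z total)) ⟩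
    x * suc (suc e) * K ! + (e * suc (e + x) * K ! + z * suc e * K !)
      ≡⟨ collect x e z (K !) ⟩
    suc e * ((2 * x + e + z) * K !)
      ≡⟨ cong (λ m → suc e * (m * K !)) total ⟩
    suc e * suc K ! ∎
    where
    open ≡-Reasoning
    T V I : List (Config x z)
    T = topClique x e z
    V = noTop x e z
    I = topIndep x e z
    split : length (T ++ V ++ I) ≡ length T + (length V + length I)
    split = trans (length-++ T) (cong (length T +_) (length-++ V))
    distrib : ∀ t v i w → (t + (v + i)) * w ≡ t * w + (v * w + i * w)
    distrib = solve-∀
    collect : ∀ x e z k → x * (2 + e) * k + (e * (1 + (e + x)) * k + z * (1 + e) * k)
                          ≡ (1 + e) * ((2 * x + e + z) * k)
    collect = solve-∀

  length-topClique : ∀ x e z {K} → 2 * x + e + z ≡ suc K →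
                     length (topClique x e z) * weight x e z ≡ x * suc (suc e) * K !
  length-topClique zero    e z _ = refl
  length-topClique (suc x) e z {K} total = begin
    length (map _ (admissibles x (suc e) z)) * weight (suc x) e z
      ≡⟨ cong (_* weight (suc x) e z) (length-map _ (admissibles x (suc e) z)) ⟩
    L * (suc x * x ! * suc (e + suc x) ! * z !)
      ≡⟨ cong (λ m → L * (suc x * x ! * suc m ! * z !)) (+-suc e x) ⟩
    L * (suc x * x ! * suc (suc e + x) ! * z !)
      ≡⟨ pull (suc x) L (x !) (suc (suc e + x) !) (z !) ⟩
    suc x * (L * weight x (suc e) z)
      ≡⟨ cong (suc x *_) (length-admissibles x (suc e) z) ⟩
    suc x * (suc (suc e) * (2 * x + suc e + z) !)
      ≡⟨ cong (λ m → suc x * (suc (suc e) * m !)) K≡ ⟨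
    suc x * (suc (suc e) * K !)
      ≡⟨ *-assoc (suc x) (suc (suc e)) (K !) ⟨
    suc x * suc (suc e) * K ! ∎
    where
    open ≡-Reasoning
    L : ℕ
    L = length (admissibles x (suc e) z)
    pull : ∀ s l a f c → l * (s * a * f * c) ≡ s * (l * (a * f * c))
    pull = solve-∀
    rearrange : ∀ x e z → 2 * (1 + x) + e + z ≡ 1 + (2 * x + (1 + e) + z)
    rearrange = solve-∀
    K≡ : K ≡ 2 * x + suc e + z
    K≡ = suc-injective (trans (sym total) (rearrange x e z))

  length-noTop : ∀ x e z {K} → 2 * x + e + z ≡ suc K →
                 length (noTop x e z) * weight x e z ≡ e * suc (e + x) * K !
  length-noTop x zero    z _ = refl
  length-noTop x (suc e) z {K} total = begin
    L * (x ! * (suc (suc e + x) * suc (e + x) !) * z !)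
      ≡⟨ pull (suc (suc e + x)) L (x !) (suc (e + x) !) (z !) ⟩
    suc (suc e + x) * (L * weight x e z)
      ≡⟨ cong (suc (suc e + x) *_) (length-admissibles x e z) ⟩
    suc (suc e + x) * (suc e * (2 * x + e + z) !)
      ≡⟨ cong (λ m → suc (suc e + x) * (suc e * m !)) K≡ ⟨
    suc (suc e + x) * (suc e * K !)
      ≡⟨ swap (suc (suc e + x)) (suc e) (K !) ⟩
    suc e * suc (suc e + x) * K ! ∎
    where
    open ≡-Reasoning
    L : ℕ
    L = length (admissibles x e z)
    pull : ∀ s l a f c → l * (a * (s * f) * c) ≡ s * (l * (a * f * c))
    pull = solve-∀
    swap : ∀ s e k → s * (e * k) ≡ e * s * k
    swap = solve-∀
    K≡ : K ≡ 2 * x + e + z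
    K≡ = suc-injective (trans (sym total) (cong (_+ z) (+-suc (2 * x) e)))

  length-topIndep : ∀ x e z {K} → 2 * x + e + z ≡ suc K →
                    length (topIndep x e z) * weight x e z ≡ z * suc e * K !
  length-topIndep x e zero    _ = refl
  length-topIndep x e (suc z) {K} total = begin
    length (map _ (admissibles x e z)) * weight x e (suc z)
      ≡⟨ cong (_* weight x e (suc z)) (length-map _ (admissibles x e z)) ⟩
    L * (x ! * suc (e + x) ! * (suc z * z !))
      ≡⟨ pull (suc z) L (x !) (suc (e + x) !) (z !) ⟩
    suc z * (L * weight x e z)
      ≡⟨ cong (suc z *_) (length-admissibles x e z) ⟩
    suc z * (suc e * (2 * x + e + z) !)
      ≡⟨ cong (λ m → suc z * (suc e * m !)) K≡ ⟨
    suc z * (suc e * K !)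
      ≡⟨ *-assoc (suc z) (suc e) (K !) ⟨
    suc z * suc e * K ! ∎
    where
    open ≡-Reasoning
    L : ℕ
    L = length (admissibles x e z)
    pull : ∀ s l a f c → l * (a * f * (s * c)) ≡ s * (l * (a * f * c))
    pull = solve-∀
    K≡ : K ≡ 2 * x + e + z
    K≡ = suc-injective (trans (sym total) (+-suc (2 * x + e) z))

C*factorials : ∀ {m k N} → m + k ≡ N → (N C m) * (m ! * k !) ≡ N !
C*factorials {m} {k} refl = subst (λ j → ((m + k) C m) * (m ! * j !) ≡ (m + k) !) (m+n∸m≡n m k)
  (trans (cong (_* (m ! * (m + k ∸ m) !)) (nCk≡n!/k![n-k]! m≤m+k))
         (m/n*n≡m {{m !* (m + k ∸ m) !≢0}} (k![n∸k]!∣n! m≤m+k)))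
  where
  m≤m+k : m ≤ m + k
  m≤m+k = m≤m+n m k

module FromFactorials (n d ℓ : ℕ) (count : ℓ * (n ! * suc n ! * d !) ≡ (2 * n + d) !) where

  [1+n]ℓ≡[2n+d]Cn*[n+d]Cn : suc n * ℓ ≡ ((2 * n + d) C n) * ((n + d) C n)
  [1+n]ℓ≡[2n+d]Cn*[n+d]Cn = *-cancelʳ-≡ (suc n * ℓ) _ (n ! * n ! * d !) {{n!n!d!≢0}} (trans lhs (sym rhs))
    where
    n!n!d!≢0 : NonZero (n ! * n ! * d !)
    n!n!d!≢0 = m*n≢0 (n ! * n !) (d !) {{n !* n !≢0}} {{d !≢0}}
    open ≡-Reasoning
    lhs : suc n * ℓ * (n ! * n ! * d !) ≡ (2 * n + d) !
    lhs = trans (regroup (suc n) ℓ (n !) (d !)) count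
      where
      regroup : ∀ s l a c → s * l * (a * a * c) ≡ l * (a * (s * a) * c)
      regroup = solve-∀
    rhs : ((2 * n + d) C n) * ((n + d) C n) * (n ! * n ! * d !) ≡ (2 * n + d) !
    rhs = begin
      ((2 * n + d) C n) * ((n + d) C n) * (n ! * n ! * d !)
        ≡⟨ regroup ((2 * n + d) C n) ((n + d) C n) (n !) (d !) ⟩
      ((2 * n + d) C n) * (n ! * (((n + d) C n) * (n ! * d !)))
        ≡⟨ cong (λ m → ((2 * n + d) C n) * (n ! * m)) (C*factorials {n} {d} refl) ⟩
      ((2 * n + d) C n) * (n ! * (n + d) !)
        ≡⟨ C*factorials {n} {n + d} (split n d) ⟩
      (2 * n + d) ! ∎
      where
      regroup : ∀ c₁ c₂ a c → c₁ * c₂ * (a * a * c) ≡ c₁ * (a * (c₂ * (a * c)))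
      regroup = solve-∀
      split : ∀ n d → n + (n + d) ≡ 2 * n + d
      split = solve-∀

  [1+2n]ℓ≡[1+2n]Cn*[2n+d]Cd : suc (2 * n) * ℓ ≡ ((suc (2 * n)) C n) * ((2 * n + d) C d)
  [1+2n]ℓ≡[1+2n]Cn*[2n+d]Cd = *-cancelʳ-≡ (suc (2 * n) * ℓ) _ (n ! * suc n ! * d ! * (2 * n) !)
                                {{n![n+1]!d![2n]!≢0}} (trans lhs (sym rhs))
    where
    n![n+1]!d![2n]!≢0 : NonZero (n ! * suc n ! * d ! * (2 * n) !)
    n![n+1]!d![2n]!≢0 = m*n≢0 (n ! * suc n ! * d !) ((2 * n) !)
      {{m*n≢0 (n ! * suc n !) (d !) {{n !* suc n !≢0}} {{d !≢0}}}} {{(2 * n) !≢0}}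
    open ≡-Reasoning
    lhs : suc (2 * n) * ℓ * (n ! * suc n ! * d ! * (2 * n) !) ≡ (2 * n + d) ! * suc (2 * n) !
    lhs = trans (regroup (suc (2 * n)) ℓ (n ! * suc n ! * d !) ((2 * n) !)) (cong (_* suc (2 * n) !) count)
      where
      regroup : ∀ s l w f → s * l * (w * f) ≡ l * w * (s * f)
      regroup = solve-∀
    rhs : ((suc (2 * n)) C n) * ((2 * n + d) C d) * (n ! * suc n ! * d ! * (2 * n) !)
          ≡ (2 * n + d) ! * suc (2 * n) !
    rhs = begin
      ((suc (2 * n)) C n) * ((2 * n + d) C d) * (n ! * suc n ! * d ! * (2 * n) !)
        ≡⟨ regroup ((suc (2 * n)) C n) ((2 * n + d) C d) (n !) (suc n !) (d !) ((2 * n) !) ⟩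
      (((suc (2 * n)) C n) * (n ! * suc n !)) * (((2 * n + d) C d) * (d ! * (2 * n) !))
        ≡⟨ cong₂ _*_ (C*factorials {n} {suc n} (split n)) (C*factorials {d} {2 * n} (+-comm d (2 * n))) ⟩
      suc (2 * n) ! * (2 * n + d) !
        ≡⟨ *-comm (suc (2 * n) !) ((2 * n + d) !) ⟩
      (2 * n + d) ! * suc (2 * n) ! ∎
      where
      regroup : ∀ c₃ c₄ a b c f → c₃ * c₄ * (a * b * c * f) ≡ (c₃ * (a * b)) * (c₄ * (c * f))
      regroup = solve-∀
      split : ∀ n → n + suc n ≡ suc (2 * n)
      split = solve-∀

corollary5p2 : (n d : ℕ) → 1 ≤ n →
    Σ (List (Config n d)) (λ L →
      Unique L × All SortedRecurrent L × (∀ c → SortedRecurrent c → c ∈ L)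
      × ((suc n) * length L ≡ ((2 * n + d) C n) * ((n + d) C n))
      × ((suc (2 * n)) * length L ≡ ((suc (2 * n)) C n) * ((2 * n + d) C d)))
corollary5p2 n d _ =
  admissibles n 0 d ,
  admissibles-unique n 0 d ,
  All.map (Equivalence.from (sortedRecurrent⇔admissible _)) (admissibles-sound n 0 d) ,
  (λ c sr → admissibles-complete n 0 d c (Equivalence.to (sortedRecurrent⇔admissible c) sr)) ,
  [1+n]ℓ≡[2n+d]Cn*[n+d]Cn , [1+2n]ℓ≡[1+2n]Cn*[2n+d]Cd
  where
  count : length (admissibles n 0 d) * (n ! * suc n ! * d !) ≡ (2 * n + d) !
  count = trans (length-admissibles n 0 d) (trans (+-identityʳ _) (cong (λ m → (m + d) !) (+-identityʳ (2 * n))))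
  open FromFactorials n d (length (admissibles n 0 d)) count
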